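{- Let $r\ge 2$ be an integer and let $F$ be a graph with at least two edges and no isolated vertex such that $F$ is not a star (i.e., the edges of $F$ have no common vertex). Then for every positive integer $n$, \[\left(1-\frac{r-1}{n}\right){\rm ex}_{r-1}(n, {\rm B}_{\rm ind} F) \leq {\rm ex}_{r}(n, {\rm B}_{\rm ind} F).\]
   Context: A $k$-uniform hypergraph $\mathcal H$ is a family of $k$-element subsets (edges) of a finite vertex set $V(\mathcal H)$. For a graph $F$ with vertex set $\{v_1,\dots,v_p\}$ and edge set $\{e_1,\dots,e_q\}$, $\mathcal H$ contains an induced Berge $F$ if there exist distinct vertices $W=\{w_1,\dots,w_p\}\subseteq V(\mathcal H)$ and distinct edges $f_1,\dots,f_q$ of $\mathcal H$ such that whenever $e_i=v_\alpha v_\beta$ we have $f_i\cap W=\{w_\alpha,w_\beta\}$. ${\rm ex}_k(n,{\rm B}_{\rm ind}F)$ is the maximum number of edges of a $k$-uniform hypergraph on an $n$-element vertex set with no induced Berge $F$. -}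

module Defs where

open import Data.Nat using (ℕ; _≤_; _∸_; _*_)
open import Data.Fin using (Fin)
open import Data.Fin.Subset using (Subset; _∈_; ∣_∣)
open import Data.Product using (_×_; _,_; proj₁; proj₂; Σ; ∃)
open import Data.Sum using (_⊎_)
open import Relation.Binary.PropositionalEquality using (_≡_; _≢_)
open import Relation.Nullary using (¬_)
open import Function.Definitions using (Injective)
open import Function.Bundles using (_⇔_)

-- A finite simple graph F with vertex set Fin p and edge list e : Fin q → Fin p × Fin p
-- (edge i is the unordered pair {proj₁ (e i), proj₂ (e i)}).
record Graph : Set where
  field
    p : ℕ
    q : ℕ
    e : Fin q → Fin p × Fin p
    loopless : ∀ i → proj₁ (e i) ≢ proj₂ (e i)
    simple : ∀ i j → i ≢ j →
      ¬ ((proj₁ (e i) ≡ proj₁ (e j) × proj₂ (e i) ≡ proj₂ (e j))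
         ⊎ (proj₁ (e i) ≡ proj₂ (e j) × proj₂ (e i) ≡ proj₁ (e j)))

open Graph public

Incident : (F : Graph) → Fin (p F) → Fin (q F) → Set
Incident F v i = v ≡ proj₁ (e F i) ⊎ v ≡ proj₂ (e F i)

NoIsolatedVertex : Graph → Set
NoIsolatedVertex F = ∀ v → ∃ λ i → Incident F v i

IsStar : Graph → Set
IsStar F = ∃ λ v → ∀ i → Incident F v i

record UHypergraph (k n : ℕ) : Set where
  field
    m : ℕ
    edge : Fin m → Subset n
    distinct : Injective _≡_ _≡_ edge
    uniform : ∀ j → ∣ edge j ∣ ≡ k

open UHypergraph public

-- H contains an induced Berge F: distinct vertices w_1..w_p and distinct edges f_1..f_q
-- with f_i ∩ W = {w_a, w_b} whenever e_i = v_a v_b.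
ContainsInducedBerge : ∀ {k n} → UHypergraph k n → Graph → Set
ContainsInducedBerge {k} {n} H F =
  Σ (Fin (p F) → Fin n) λ w →
  Σ (Fin (q F) → Fin (m H)) λ f →
    Injective _≡_ _≡_ w × Injective _≡_ _≡_ f ×
    (∀ i x → (w x ∈ edge H (f i)) ⇔ Incident F x i)

IsEx : ℕ → ℕ → Graph → ℕ → Set
IsEx k n F t =
  (Σ (UHypergraph k n) λ H → ¬ ContainsInducedBerge H F × m H ≡ t)
  × (∀ (H : UHypergraph k n) → ¬ ContainsInducedBerge H F → m H ≤ t)

-- Take an extremal (r-1)-graph H with no induced Berge F. For each vertex v, the cone
-- H_v = { e ∪ {v} : e ∈ H, v ∉ e } is an r-graph, and it still has no induced Berge F:
-- a copy using v as a branch vertex would have v in every edge, making F a star, and a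
-- copy avoiding v restricts to a copy in H. Hence ex_r ≥ |H_v| for every v, while double
-- counting pairs (v, e) with v ∉ e gives ∑_v |H_v| = (n - (r-1)) · ex_{r-1}.
module Submission where

open import Defs
open import Data.Nat using (ℕ; _≤_; _∸_; _*_; suc; zero; _+_; z≤n)
open import Relation.Nullary using (¬_; yes; no)

open import Data.Nat.Properties using (+-0-commutativeMonoid; +-mono-≤; *-comm; module ≤-Reasoning)
open import Algebra.Properties.CommutativeMonoid.Sum +-0-commutativeMonoid
  using (sum-syntax; ∑-comm; sum-cong-≗)
open import Data.Bool using (Bool; true; false; not; if_then_else_)
open import Data.Empty using (⊥-elim)
open import Data.Fin using (Fin; zero; suc)
open import Data.Fin.Properties using (any?; suc-injective) renaming (_≟_ to _≟ᶠ_)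
open import Data.Fin.Subset using (Subset; _∈_; _∉_; _⊆_; _∪_; ⁅_⁆; ∁; ∣_∣)
open import Data.Fin.Subset.Properties
  using (x∈p∪q⁺; x∈p∪q⁻; x∈⁅x⁆; x∈⁅y⁆⇒x≡y; ∪-identityʳ; ⊆-reflexive; ⊆-antisym; ∣∁p∣≡n∸∣p∣)
open import Data.Product using (_,_; ∃)
open import Data.Sum using (inj₁; inj₂)
open import Data.Vec using (_∷_; here; there; lookup; tabulate; map)
open import Data.Vec.Properties using (lookup∘tabulate; tabulate-∘; tabulate∘lookup; []=⇒lookup)
open import Function using (_∘_)
open import Function.Bundles using (_⇔_; mk⇔; Equivalence)
open import Function.Construct.Composition using (_⇔-∘_)
open import Function.Construct.Symmetry using (⇔-sym)
open import Function.Definitions using (Injective)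
open import Relation.Binary.PropositionalEquality

∑-const : ∀ n c → ∑[ i < n ] c ≡ n * c
∑-const zero    c = refl
∑-const (suc n) c = cong (c +_) (∑-const n c)

∑-≤-* : ∀ {n c} (f : Fin n → ℕ) → (∀ i → f i ≤ c) → ∑[ i < n ] f i ≤ n * c
∑-≤-* {zero}  f f≤c = z≤n
∑-≤-* {suc n} f f≤c = +-mono-≤ (f≤c zero) (∑-≤-* (f ∘ suc) (f≤c ∘ suc))

∣tabulate∣≡∑ : ∀ {n} (f : Fin n → Bool) → ∣ tabulate f ∣ ≡ ∑[ i < n ] (if f i then 1 else 0)
∣tabulate∣≡∑ {zero}  f = refl
∣tabulate∣≡∑ {suc n} f with f zero
... | true  = cong suc (∣tabulate∣≡∑ (f ∘ suc))
... | false = ∣tabulate∣≡∑ (f ∘ suc)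

∑∣tabulate∣-transpose : ∀ {a b} (R : Fin a → Fin b → Bool) →
  ∑[ i < a ] ∣ tabulate (R i) ∣ ≡ ∑[ j < b ] ∣ tabulate (λ i → R i j) ∣
∑∣tabulate∣-transpose R = begin
  ∑[ i < _ ] ∣ tabulate (R i) ∣                           ≡⟨ sum-cong-≗ (∣tabulate∣≡∑ ∘ R) ⟩
  ∑[ i < _ ] ∑[ j < _ ] (if R i j then 1 else 0)         ≡⟨ ∑-comm (λ i j → if R i j then 1 else 0) ⟩
  ∑[ j < _ ] ∑[ i < _ ] (if R i j then 1 else 0)         ≡⟨ sym (sum-cong-≗ (λ j → ∣tabulate∣≡∑ (λ i → R i j))) ⟩
  ∑[ j < _ ] ∣ tabulate (λ i → R i j) ∣                   ∎
  where open ≡-Reasoning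

tabulate-not∘lookup : ∀ {n} (p : Subset n) → tabulate (not ∘ lookup p) ≡ ∁ p
tabulate-not∘lookup p = trans (tabulate-∘ not (lookup p)) (cong (map not) (tabulate∘lookup p))

enumerate : ∀ {n} (p : Subset n) → Fin ∣ p ∣ → Fin n
enumerate (true  ∷ p) zero    = zero
enumerate (true  ∷ p) (suc i) = suc (enumerate p i)
enumerate (false ∷ p) i       = suc (enumerate p i)

enumerate-∈ : ∀ {n} (p : Subset n) i → enumerate p i ∈ p
enumerate-∈ (true  ∷ p) zero    = here
enumerate-∈ (true  ∷ p) (suc i) = there (enumerate-∈ p i)
enumerate-∈ (false ∷ p) i       = there (enumerate-∈ p i)

enumerate-injective : ∀ {n} (p : Subset n) → Injective _≡_ _≡_ (enumerate p)
enumerate-injective (true  ∷ p) {zero}  {zero}  _  = refl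
enumerate-injective (true  ∷ p) {suc i} {suc j} eq = cong suc (enumerate-injective p (suc-injective eq))
enumerate-injective (false ∷ p)                 eq = enumerate-injective p (suc-injective eq)

∈p∪⁅y⁆⇔∈p : ∀ {n} {p : Subset n} {x y} → x ≢ y → x ∈ p ∪ ⁅ y ⁆ ⇔ x ∈ p
∈p∪⁅y⁆⇔∈p {p = p} {x} {y} x≢y = mk⇔ from-∪ (x∈p∪q⁺ ∘ inj₁)
  where
  from-∪ : x ∈ p ∪ ⁅ y ⁆ → x ∈ p
  from-∪ x∈ with x∈p∪q⁻ p ⁅ y ⁆ x∈
  ... | inj₁ x∈p = x∈p
  ... | inj₂ x∈y = ⊥-elim (x≢y (x∈⁅y⁆⇒x≡y y x∈y))

∣p∪⁅x⁆∣≡1+∣p∣ : ∀ {n} (p : Subset n) {x} → x ∉ p → ∣ p ∪ ⁅ x ⁆ ∣ ≡ suc ∣ p ∣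
∣p∪⁅x⁆∣≡1+∣p∣ (false ∷ p) {zero}  _   = cong (suc ∘ ∣_∣) (∪-identityʳ p)
∣p∪⁅x⁆∣≡1+∣p∣ (true  ∷ p) {zero}  x∉p = ⊥-elim (x∉p here)
∣p∪⁅x⁆∣≡1+∣p∣ (true  ∷ p) {suc x} x∉p = cong suc (∣p∪⁅x⁆∣≡1+∣p∣ p (x∉p ∘ there))
∣p∪⁅x⁆∣≡1+∣p∣ (false ∷ p) {suc x} x∉p = ∣p∪⁅x⁆∣≡1+∣p∣ p (x∉p ∘ there)

∪⁅x⁆-cancel-⊆ : ∀ {n} {p q : Subset n} {x} → x ∉ p → p ∪ ⁅ x ⁆ ⊆ q ∪ ⁅ x ⁆ → p ⊆ q
∪⁅x⁆-cancel-⊆ x∉p p∪x⊆q∪x {y} y∈p =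
  Equivalence.to (∈p∪⁅y⁆⇔∈p (λ { refl → x∉p y∈p })) (p∪x⊆q∪x (x∈p∪q⁺ (inj₁ y∈p)))

∪⁅x⁆-injective : ∀ {n} {p q : Subset n} {x} → x ∉ p → x ∉ q → p ∪ ⁅ x ⁆ ≡ q ∪ ⁅ x ⁆ → p ≡ q
∪⁅x⁆-injective x∉p x∉q eq =
  ⊆-antisym (∪⁅x⁆-cancel-⊆ x∉p (⊆-reflexive eq)) (∪⁅x⁆-cancel-⊆ x∉q (⊆-reflexive (sym eq)))

avoiding : ∀ {k n} (H : UHypergraph k n) → Fin n → Subset (m H)
avoiding H v = tabulate (λ j → not (lookup (edge H j) v))

∈-avoiding⇒∉ : ∀ {k n} {H : UHypergraph k n} {v j} → j ∈ avoiding H v → v ∉ edge H j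
∈-avoiding⇒∉ {H = H} {v} {j} j∈ v∈ = false≢true (begin
  false                                                 ≡⟨ cong not ([]=⇒lookup v∈) ⟨
  not (lookup (edge H j) v)                             ≡⟨ lookup∘tabulate _ j ⟨
  lookup (avoiding H v) j                               ≡⟨ []=⇒lookup j∈ ⟩
  true                                                  ∎)
  where
  open ≡-Reasoning
  false≢true : false ≢ true
  false≢true ()

cone : ∀ {k n} → UHypergraph k n → Fin n → UHypergraph (suc k) n
cone H v = record
  { m        = ∣ avoiding H v ∣
  ; edge     = λ i → base i ∪ ⁅ v ⁆
  ; distinct = λ {i} {j} eq →
      enumerate-injective (avoiding H v) (distinct H (∪⁅x⁆-injective (v∉base i) (v∉base j) eq))
  ; uniform  = λ i → trans (∣p∪⁅x⁆∣≡1+∣p∣ (base i) (v∉base i)) (cong suc (uniform H _))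
  }
  where
  base : Fin ∣ avoiding H v ∣ → Subset _
  base i = edge H (enumerate (avoiding H v) i)
  v∉base : ∀ i → v ∉ base i
  v∉base i = ∈-avoiding⇒∉ {H = H} (enumerate-∈ (avoiding H v) i)

∑-m-cone : ∀ {k n} (H : UHypergraph k n) → ∑[ v < n ] m (cone H v) ≡ (n ∸ k) * m H
∑-m-cone {k} {n} H = begin
  ∑[ v < n ] ∣ avoiding H v ∣                                     ≡⟨ ∑∣tabulate∣-transpose (λ v j → not (lookup (edge H j) v)) ⟩
  ∑[ j < m H ] ∣ tabulate (λ v → not (lookup (edge H j) v)) ∣     ≡⟨ sum-cong-≗ ∣complement∣ ⟩
  ∑[ j < m H ] (n ∸ k)                                            ≡⟨ ∑-const (m H) (n ∸ k) ⟩
  m H * (n ∸ k)                                                   ≡⟨ *-comm (m H) (n ∸ k) ⟩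
  (n ∸ k) * m H                                                   ∎
  where
  open ≡-Reasoning
  ∣complement∣ : ∀ j → ∣ tabulate (λ v → not (lookup (edge H j) v)) ∣ ≡ n ∸ k
  ∣complement∣ j = begin
    ∣ tabulate (not ∘ lookup (edge H j)) ∣  ≡⟨ cong ∣_∣ (tabulate-not∘lookup (edge H j)) ⟩
    ∣ ∁ (edge H j) ∣                        ≡⟨ ∣∁p∣≡n∸∣p∣ (edge H j) ⟩
    n ∸ ∣ edge H j ∣                        ≡⟨ cong (n ∸_) (uniform H j) ⟩
    n ∸ k                                   ∎

cone-apex⇒star : ∀ {k n} (H : UHypergraph k n) v F → ((w , _) : ContainsInducedBerge (cone H v) F) →
  (∃ λ x → w x ≡ v) → IsStar F
cone-apex⇒star H v F (w , f , _ , _ , w∈⇔) (x , refl) =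
  x , λ i → Equivalence.to (w∈⇔ i x) (x∈p∪q⁺ (inj₂ (x∈⁅x⁆ (w x))))

cone-Berge⇒Berge : ∀ {k n} (H : UHypergraph k n) v F → ((w , _) : ContainsInducedBerge (cone H v) F) →
  (∀ x → w x ≢ v) → ContainsInducedBerge H F
cone-Berge⇒Berge H v F (w , f , w-inj , f-inj , w∈⇔) w≢v =
  w , enumerate (avoiding H v) ∘ f , w-inj , f-inj ∘ enumerate-injective (avoiding H v) ,
  λ i x → w∈⇔ i x ⇔-∘ ⇔-sym (∈p∪⁅y⁆⇔∈p (w≢v x))

cone-free : ∀ {k n} (H : UHypergraph k n) v F → ¬ IsStar F →
  ¬ ContainsInducedBerge H F → ¬ ContainsInducedBerge (cone H v) F
cone-free H v F not-star H-free c@(w , _) with any? (λ x → w x ≟ᶠ v)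
... | yes hit  = not-star (cone-apex⇒star H v F c hit)
... | no  miss = H-free (cone-Berge⇒Berge H v F c (λ x eq → miss (x , eq)))

mainTheorem6 : (r : ℕ) → 2 ≤ r → (F : Graph) → 2 ≤ q F → NoIsolatedVertex F → ¬ IsStar F →
    (n : ℕ) → 1 ≤ n → (a b : ℕ) → IsEx (r ∸ 1) n F a → IsEx r n F b →
    (n ∸ (r ∸ 1)) * a ≤ n * b
mainTheorem6 (suc r) _ F _ _ not-star n _ _ b ((H , H-free , refl) , _) (_ , maximal) = begin
  (n ∸ r) * m H              ≡⟨ ∑-m-cone H ⟨
  ∑[ v < n ] m (cone H v)    ≤⟨ ∑-≤-* (m ∘ cone H) (λ v → maximal (cone H v) (cone-free H v F not-star H-free)) ⟩
  n * b                      ∎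
  where open ≤-Reasoning
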